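{- Let $D$ be a blowup of a directed $r$-cycle with parts $V_1,\dots,V_r$. (a) If $m(D)$ is odd, then $A_D(-1)=0$. (b) If $m(D)$ is even, then $(-1)^{m(D)/2}A_D(-1)\ge 0$ and \[(-1)^{m(D)/2}A_D(-1)=\sum_{v\in V(D)}(-1)^{m(D-v)/2}A_{D-v}(-1),\] where each summand with $m(D-v)$ odd is interpreted as $0$ (consistent with (a), since then $A_{D-v}(-1)=0$).
   Context: A blowup of a directed $r$-cycle is a digraph with vertex set $V_1\cup\cdots\cup V_r$ (disjoint parts) and arcs $u\to v$ exactly when $u\in V_i$ and $v\in V_{i+1}$ for some $i$ (indices modulo $r$). For such $D$, $m(D)$ is the number of $i\in[r]$ such that $|V_i|$ and $|V_{i+1}|$ are both odd. For $v\in V(D)$, $D-v$ is again such a blowup with parts $V_1,\dots,V_r$ with $v$ removed from its part, and $m(D-v)$ is computed with these parts. For an $n$-vertex digraph $D$, a descent of a bijection $\sigma:V(D)\to[n]$ is an arc $u\to v$ with $\sigma(u)>\sigma(v)$ and $A_D(t)=\sum_\sigma t^{\mathrm{des}_D(\sigma)}$ with $\mathrm{des}_D(\sigma)$ the number of descents. -}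

module Defs where

open import Data.Nat as ℕ using (ℕ; zero; suc; _%_; _/_)
open import Data.Nat.DivMod using (_mod_)
open import Data.Fin using (Fin; toℕ; punchIn)
open import Data.Fin.Properties using (all?; any?) renaming (_≟_ to _≟ᶠ_)
open import Data.Integer as ℤ using (ℤ; -1ℤ; 0ℤ; _^_)
open import Data.List using (List; []; _∷_; map; concatMap; filter; length; foldr; allFin)
open import Data.Vec.Functional using () renaming (_∷_ to _∷ᶠ_)
open import Data.Product using (∃)
open import Function using (_∘_)
open import Relation.Nullary using (Dec; yes; no)
open import Relation.Nullary.Decidable using (_×-dec_; _→-dec_)
open import Relation.Binary.PropositionalEquality using (_≡_)

-- Vertex set of an n-vertex blowup of the directed r-cycle is Fin n;
-- part : Fin n → Fin r assigns each vertex to its part (V_i = part⁻¹(i)).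

next : ∀ {r} → Fin r → Fin r
next {suc k} i = suc (toℕ i) mod suc k

Arc : ∀ {n r} → (Fin n → Fin r) → Fin n → Fin n → Set
Arc part u v = part v ≡ next (part u)

arc? : ∀ {n r} (part : Fin n → Fin r) (u v : Fin n) → Dec (Arc part u v)
arc? part u v = part v ≟ᶠ next (part u)

partSize : ∀ {n r} → (Fin n → Fin r) → Fin r → ℕ
partSize {n} part i = length (filter (λ v → part v ≟ᶠ i) (allFin n))

Odd : ℕ → Set
Odd k = k % 2 ≡ 1

odd? : (k : ℕ) → Dec (Odd k)
odd? k = (k % 2) ℕ.≟ 1

mD : ∀ {n r} → (Fin n → Fin r) → ℕ
mD {r = r} part =
  length (filter (λ i → odd? (partSize part i) ×-dec odd? (partSize part (next i))) (allFin r))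

des : ∀ {n r} → (Fin n → Fin r) → (Fin n → Fin n) → ℕ
des {n} part σ =
  length (filter (λ uv → arc? part (Data.Product.proj₁ uv) (Data.Product.proj₂ uv)
                          ×-dec (σ (Data.Product.proj₂ uv) Data.Fin.<? σ (Data.Product.proj₁ uv)))
                 (Data.List.cartesianProduct (allFin n) (allFin n)))
  where import Data.Product; import Data.Fin; import Data.List

allFuns : (n m : ℕ) → List (Fin n → Fin m)
allFuns zero    m = (λ ()) ∷ []
allFuns (suc n) m = concatMap (λ f → map (λ j → j ∷ᶠ f) (allFin m)) (allFuns n m)

IsBijection : ∀ {n} → (Fin n → Fin n) → Set
IsBijection {n} f = ((i j : Fin n) → f i ≡ f j → i ≡ j) Data.Product.× ((y : Fin n) → ∃ λ x → f x ≡ y)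
  where import Data.Product

isBijection? : ∀ {n} (f : Fin n → Fin n) → Dec (IsBijection f)
isBijection? f =
  all? (λ i → all? (λ j → (f i ≟ᶠ f j) →-dec (i ≟ᶠ j)))
  ×-dec all? (λ y → any? (λ x → f x ≟ᶠ y))

bijections : (n : ℕ) → List (Fin n → Fin n)
bijections n = filter isBijection? (allFuns n n)

sumℤ : List ℤ → ℤ
sumℤ = foldr ℤ._+_ 0ℤ

AD-1 : ∀ {n r} → (Fin n → Fin r) → ℤ
AD-1 {n} part = sumℤ (map (λ σ → -1ℤ ^ des part σ) (bijections n))

signedA : ∀ {n r} → (Fin n → Fin r) → ℤ
signedA part with odd? (mD part)
... | yes _ = 0ℤ
... | no  _ = (-1ℤ ^ (mD part / 2)) ℤ.* AD-1 part

deleteVertex : ∀ {n r} → (Fin (suc n) → Fin r) → Fin (suc n) → (Fin n → Fin r)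
deleteVertex part v = part ∘ punchIn v

deletionSum : ∀ {n r} → (Fin (suc n) → Fin r) → ℤ
deletionSum {n} part = sumℤ (map (λ v → signedA (deleteVertex part v)) (allFin (suc n)))

-- Give a vertex v the smallest label: the descents through v are then exactly the arcs into v, so
-- A_D(-1) = Σ_v (-1)^{indeg v} A_{D-v}(-1); with the largest label the exponent is outdeg v instead.
-- In a blowup of a cycle, with p the part of v, indeg v = |V_{p-1}| and outdeg v = |V_{p+1}|, and
-- deleting v flips the parity of |V_p|. Hence m(D) and m(D-v) differ, in one direction or the other,
-- by the number t of odd sizes among |V_{p-1}|, |V_{p+1}|.
-- If m(D) is odd, every v with m(D-v) even has t = 1, so (-1)^{indeg v} + (-1)^{outdeg v} = 0; adding
-- the two expansions and using induction for the terms with m(D-v) odd gives 2 A_D(-1) = 0.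
-- If m(D) is even, every v with m(D-v) even has t ∈ {0, 2}, and then
-- (-1)^{m(D)/2 + indeg v} = (-1)^{m(D-v)/2}, which turns the first expansion into the deletion
-- identity; nonnegativity follows from it by induction on the number of vertices.

module Submission where

open import Defs
open import Data.Nat using (ℕ; zero; suc; _≤_; _/_)
open import Data.Fin using (Fin)
open import Data.Integer using (0ℤ; -1ℤ; _^_; _*_) renaming (_≤_ to _≤ℤ_)
open import Data.Product using (_×_; _,_; proj₁; proj₂; ∃)
open import Relation.Nullary using (¬_; Dec; yes; no; does)
open import Relation.Binary.PropositionalEquality
  using (_≡_; _≢_; _≗_; refl; sym; trans; cong; cong₂; subst; module ≡-Reasoning)

open import Data.Bool using (if_then_else_; true; false)
open import Data.Empty using (⊥-elim)
open import Data.Fin as Fin using (zero; suc; toℕ; inject₁; punchIn; punchOut; fromℕ; _<?_)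
open import Data.Fin.Properties
  using ( all?; toℕ-fromℕ<; toℕ-fromℕ; toℕ-inject₁; toℕ-injective; toℕ<n; ≤fromℕ; <-irrefl; ≤∧≢⇒<; <⇒≢
        ; punchIn-mono-≤; punchIn-cancel-≤; punchInᵢ≢i; punchIn-injective; punchOut-injective
        ; punchIn-punchOut; punchOut-punchIn; punchOut-cong)
  renaming (_≟_ to _≟ᶠ_)
open import Data.Integer as ℤ using (ℤ; _+_; 1ℤ)
import Data.Integer.Properties as ℤP
open import Data.List using (List; []; _∷_; map; filter; concatMap; _++_; length; allFin; tabulate; cartesianProduct)
import Data.List.Properties as ListP
import Data.Nat as ℕ
open import Data.Nat.DivMod using (m<n⇒m%n≡m; n%n≡0; m/n≡1+[m∸n]/n)
import Data.Nat.Properties as ℕP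
open import Data.Product.Function.NonDependent.Propositional using (_×-⇔_)
open import Data.Sum using (_⊎_; inj₁; inj₂)
open import Data.Vec.Functional using () renaming (_∷_ to _∷ᶠ_)
open import Function using (_∘_; _⇔_; mk⇔)
import Function.Properties.Equivalence as ⇔
open import Relation.Nullary.Decidable using (_×-dec_; does-⇔; dec-true; dec-false)
open import Relation.Nullary.Negation using (contradiction)
open import Relation.Unary using (Decidable)

open import Algebra.Properties.CommutativeSemigroup ℤP.+-commutativeSemigroup using (interchange)
import Algebra.Properties.Semiring.Sum ℕP.+-*-semiring as ℕΣ
open import Algebra.Properties.Semiring.Sum ℤP.+-*-semiring
  using (sum-remove; sum-replicate-zero; ∑-distrib-+; *-distribˡ-sum; sum-cong-≗) renaming (sum to ∑ℤ)
open ℕΣ using () renaming (sum to ∑ℕ)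
open ≡-Reasoning

𝟙 : {P : Set} → Dec P → ℕ
𝟙 d = if does d then 1 else 0

when : {P : Set} → Dec P → ℤ → ℤ
when d x = if does d then x else 0ℤ

module _ {P : Set} (p : Dec P) where

  𝟙-yes : P → 𝟙 p ≡ 1
  𝟙-yes a rewrite dec-true p a = refl

  𝟙-no : ¬ P → 𝟙 p ≡ 0
  𝟙-no ¬a rewrite dec-false p ¬a = refl

  when-yes : P → ∀ x → when p x ≡ x
  when-yes a x rewrite dec-true p a = refl

  when-no : ¬ P → ∀ x → when p x ≡ 0ℤ
  when-no ¬a x rewrite dec-false p ¬a = refl

  module _ {Q : Set} (q : Dec Q) where

    𝟙-⇔ : P ⇔ Q → 𝟙 p ≡ 𝟙 q
    𝟙-⇔ e = cong (λ b → if b then 1 else 0) (does-⇔ e p q)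

    when-⇔ : P ⇔ Q → ∀ x → when p x ≡ when q x
    when-⇔ e x = cong (λ b → if b then x else 0ℤ) (does-⇔ e p q)

    when-× : ∀ x → when (p ×-dec q) x ≡ when p (when q x)
    when-× x with does p
    ... | true  = refl
    ... | false = refl

∑ℤ-zero : ∀ {n} {f : Fin n → ℤ} → (∀ i → f i ≡ 0ℤ) → ∑ℤ f ≡ 0ℤ
∑ℤ-zero {n} e = trans (sum-cong-≗ e) (sum-replicate-zero n)

∑ℕ-zero : ∀ {n} {f : Fin n → ℕ} → (∀ i → f i ≡ 0) → ∑ℕ f ≡ 0
∑ℕ-zero {n} e = trans (ℕΣ.sum-cong-≗ e) (ℕΣ.sum-replicate-zero n)

∑ℤ-nonneg : ∀ {n} {f : Fin n → ℤ} → (∀ i → 0ℤ ≤ℤ f i) → 0ℤ ≤ℤ ∑ℤ f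
∑ℤ-nonneg {zero}  h = ℤP.≤-refl
∑ℤ-nonneg {suc n} h = ℤP.+-mono-≤ (h zero) (∑ℤ-nonneg (h ∘ suc))

∑ℤ-δ : ∀ {n} (a : Fin n) (f : Fin n → ℤ) → ∑ℤ (λ j → when (j ≟ᶠ a) (f j)) ≡ f a
∑ℤ-δ {suc n} a f = begin
  ∑ℤ (λ j → when (j ≟ᶠ a) (f j))
    ≡⟨ sum-remove {i = a} (λ j → when (j ≟ᶠ a) (f j)) ⟩
  when (a ≟ᶠ a) (f a) + ∑ℤ (λ j → when (punchIn a j ≟ᶠ a) (f (punchIn a j)))
    ≡⟨ cong₂ _+_ (when-yes (a ≟ᶠ a) refl (f a))
                    (∑ℤ-zero (λ j → when-no (punchIn a j ≟ᶠ a) (punchInᵢ≢i a j) (f (punchIn a j)))) ⟩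
  f a + 0ℤ
    ≡⟨ ℤP.+-identityʳ (f a) ⟩
  f a ∎

∑ℕ-remove² : ∀ {n} (v : Fin (suc n)) (f : Fin (suc n) → Fin (suc n) → ℕ) →
  ∑ℕ (λ u → ∑ℕ (f u)) ≡
    f v v ℕ.+ (∑ℕ (λ y → f v (punchIn v y))
          ℕ.+ (∑ℕ (λ x → f (punchIn v x) v) ℕ.+ ∑ℕ (λ x → ∑ℕ (λ y → f (punchIn v x) (punchIn v y)))))
∑ℕ-remove² v f = begin
  ∑ℕ (λ u → ∑ℕ (f u))
    ≡⟨ ℕΣ.sum-remove {i = v} (λ u → ∑ℕ (f u)) ⟩
  ∑ℕ (f v) ℕ.+ ∑ℕ (λ x → ∑ℕ (f (punchIn v x)))
    ≡⟨ cong₂ ℕ._+_ (ℕΣ.sum-remove {i = v} (f v))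
                   (ℕΣ.sum-cong-≗ (λ x → ℕΣ.sum-remove {i = v} (f (punchIn v x)))) ⟩
  (f v v ℕ.+ row) ℕ.+ ∑ℕ (λ x → f (punchIn v x) v ℕ.+ ∑ℕ (λ y → f (punchIn v x) (punchIn v y)))
    ≡⟨ cong ((f v v ℕ.+ row) ℕ.+_)
         (ℕΣ.∑-distrib-+ (λ x → f (punchIn v x) v) (λ x → ∑ℕ (λ y → f (punchIn v x) (punchIn v y)))) ⟩
  (f v v ℕ.+ row) ℕ.+ (column ℕ.+ rest)
    ≡⟨ ℕP.+-assoc (f v v) row (column ℕ.+ rest) ⟩
  f v v ℕ.+ (row ℕ.+ (column ℕ.+ rest)) ∎
  where
  row    = ∑ℕ (λ y → f v (punchIn v y))
  column = ∑ℕ (λ x → f (punchIn v x) v)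
  rest   = ∑ℕ (λ x → ∑ℕ (λ y → f (punchIn v x) (punchIn v y)))

∑ℕ-remove₂ : ∀ {n} {q p : Fin (suc (suc n))} (q≢p : q ≢ p) (f : Fin (suc (suc n)) → ℕ) →
  ∑ℕ f ≡ f q ℕ.+ (f p ℕ.+ ∑ℕ (λ y → f (punchIn q (punchIn (punchOut q≢p) y))))
∑ℕ-remove₂ {q = q} q≢p f = trans (ℕΣ.sum-remove {i = q} f) (cong (f q ℕ.+_) (trans
  (ℕΣ.sum-remove {i = punchOut q≢p} (f ∘ punchIn q))
  (cong (λ i → f i ℕ.+ ∑ℕ (λ y → f (punchIn q (punchIn (punchOut q≢p) y)))) (punchIn-punchOut q≢p))))

∑ℓ : {A : Set} → List A → (A → ℤ) → ℤ
∑ℓ xs f = sumℤ (map f xs)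

module _ {A : Set} where

  ∑ℓ-cong : (xs : List A) {f g : A → ℤ} → (∀ x → f x ≡ g x) → ∑ℓ xs f ≡ ∑ℓ xs g
  ∑ℓ-cong []       e = refl
  ∑ℓ-cong (x ∷ xs) e = cong₂ _+_ (e x) (∑ℓ-cong xs e)

  ∑ℓ-zero : (xs : List A) {f : A → ℤ} → (∀ x → f x ≡ 0ℤ) → ∑ℓ xs f ≡ 0ℤ
  ∑ℓ-zero []       e = refl
  ∑ℓ-zero (x ∷ xs) e = cong₂ _+_ (e x) (∑ℓ-zero xs e)

  ∑ℓ-+ : (xs : List A) (f g : A → ℤ) → ∑ℓ xs (λ x → f x + g x) ≡ ∑ℓ xs f + ∑ℓ xs g
  ∑ℓ-+ []       f g = refl
  ∑ℓ-+ (x ∷ xs) f g =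
    trans (cong (f x + g x +_) (∑ℓ-+ xs f g)) (interchange (f x) (g x) _ _)

  ∑ℓ-*ˡ : (xs : List A) (c : ℤ) (f : A → ℤ) → ∑ℓ xs (λ x → c * f x) ≡ c * ∑ℓ xs f
  ∑ℓ-*ˡ []       c f = sym (ℤP.*-zeroʳ c)
  ∑ℓ-*ˡ (x ∷ xs) c f =
    trans (cong (c * f x +_) (∑ℓ-*ˡ xs c f)) (sym (ℤP.*-distribˡ-+ c (f x) _))

  ∑ℓ-when : {P : Set} (d : Dec P) (xs : List A) (f : A → ℤ) →
            ∑ℓ xs (λ x → when d (f x)) ≡ when d (∑ℓ xs f)
  ∑ℓ-when d xs f with does d
  ... | true  = refl
  ... | false = ∑ℓ-zero xs (λ _ → refl)

  ∑ℓ-++ : (xs ys : List A) (f : A → ℤ) → ∑ℓ (xs ++ ys) f ≡ ∑ℓ xs f + ∑ℓ ys f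
  ∑ℓ-++ []       ys f = sym (ℤP.+-identityˡ _)
  ∑ℓ-++ (x ∷ xs) ys f = trans (cong (f x +_) (∑ℓ-++ xs ys f)) (sym (ℤP.+-assoc (f x) _ _))

  ∑ℓ-filter : {P : A → Set} (P? : Decidable P) (xs : List A) (f : A → ℤ) →
              ∑ℓ (filter P? xs) f ≡ ∑ℓ xs (λ x → when (P? x) (f x))
  ∑ℓ-filter P? []       f = refl
  ∑ℓ-filter P? (x ∷ xs) f with does (P? x)
  ... | true  = cong (f x +_) (∑ℓ-filter P? xs f)
  ... | false = trans (∑ℓ-filter P? xs f) (sym (ℤP.+-identityˡ _))

  ∑ℓ-tabulate : ∀ {n} (g : Fin n → A) (f : A → ℤ) → ∑ℓ (tabulate g) f ≡ ∑ℤ (f ∘ g)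
  ∑ℓ-tabulate {zero}  g f = refl
  ∑ℓ-tabulate {suc n} g f = cong (f (g zero) +_) (∑ℓ-tabulate (g ∘ suc) f)

module _ {A B : Set} where

  ∑ℓ-concatMap : (g : A → List B) (xs : List A) (f : B → ℤ) →
                 ∑ℓ (concatMap g xs) f ≡ ∑ℓ xs (λ x → ∑ℓ (g x) f)
  ∑ℓ-concatMap g []       f = refl
  ∑ℓ-concatMap g (x ∷ xs) f =
    trans (∑ℓ-++ (g x) _ f) (cong (∑ℓ (g x) f +_) (∑ℓ-concatMap g xs f))

  ∑ℓ-map : (g : A → B) (xs : List A) (f : B → ℤ) → ∑ℓ (map g xs) f ≡ ∑ℓ xs (f ∘ g)
  ∑ℓ-map g xs f = cong sumℤ (sym (ListP.map-∘ xs))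

  ∑ℓ-comm : (xs : List A) (ys : List B) (h : A → B → ℤ) →
            ∑ℓ xs (λ x → ∑ℓ ys (h x)) ≡ ∑ℓ ys (λ y → ∑ℓ xs (λ x → h x y))
  ∑ℓ-comm []       ys h = sym (∑ℓ-zero ys (λ _ → refl))
  ∑ℓ-comm (x ∷ xs) ys h =
    trans (cong (∑ℓ ys (h x) +_) (∑ℓ-comm xs ys h)) (sym (∑ℓ-+ ys (h x) _))

∑ℓ-allFin : ∀ n (f : Fin n → ℤ) → ∑ℓ (allFin n) f ≡ ∑ℤ f
∑ℓ-allFin n = ∑ℓ-tabulate (λ i → i)

module _ {A : Set} {P : A → Set} (P? : Decidable P) where

  length-filter-tabulate : ∀ {n} (f : Fin n → A) →
    length (filter P? (tabulate f)) ≡ ∑ℕ (λ i → 𝟙 (P? (f i)))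
  length-filter-tabulate {zero}  f = refl
  length-filter-tabulate {suc n} f with does (P? (f zero))
  ... | true  = cong suc (length-filter-tabulate (f ∘ suc))
  ... | false = length-filter-tabulate (f ∘ suc)

module _ {A B : Set} {P : A × B → Set} (P? : Decidable P) where

  length-filter-cartesianProduct : ∀ {m n} (f : Fin m → A) (g : Fin n → B) →
    length (filter P? (cartesianProduct (tabulate f) (tabulate g)))
      ≡ ∑ℕ (λ i → ∑ℕ (λ j → 𝟙 (P? (f i , g j))))
  length-filter-cartesianProduct {zero}  f g = refl
  length-filter-cartesianProduct {suc m} f g = begin
    length (filter P? (map (f zero ,_) (tabulate g) ++ rest))
      ≡⟨ cong length (ListP.filter-++ P? (map (f zero ,_) (tabulate g)) rest) ⟩
    length (filter P? (map (f zero ,_) (tabulate g)) ++ filter P? rest)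
      ≡⟨ ListP.length-++ (filter P? (map (f zero ,_) (tabulate g))) ⟩
    length (filter P? (map (f zero ,_) (tabulate g))) ℕ.+ length (filter P? rest)
      ≡⟨ cong₂ ℕ._+_ (trans (cong (length ∘ filter P?) (ListP.map-tabulate g (f zero ,_)))
                            (length-filter-tabulate P? (λ j → f zero , g j)))
                     (length-filter-cartesianProduct (f ∘ suc) g) ⟩
    ∑ℕ (λ i → ∑ℕ (λ j → 𝟙 (P? (f i , g j)))) ∎
    where rest = cartesianProduct (tabulate (f ∘ suc)) (tabulate g)

-- Labellings

_≗?_ : ∀ {n m} (f g : Fin n → Fin m) → Dec (f ≗ g)
f ≗? g = all? (λ i → f i ≟ᶠ g i)

∑ℓ-allFuns-suc : ∀ n m (h : (Fin (suc n) → Fin m) → ℤ) →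
  ∑ℓ (allFuns (suc n) m) h ≡ ∑ℓ (allFuns n m) (λ f → ∑ℤ (λ j → h (j ∷ᶠ f)))
∑ℓ-allFuns-suc n m h = begin
  ∑ℓ (concatMap (λ f → map (_∷ᶠ f) (allFin m)) (allFuns n m)) h
    ≡⟨ ∑ℓ-concatMap (λ f → map (_∷ᶠ f) (allFin m)) (allFuns n m) h ⟩
  ∑ℓ (allFuns n m) (λ f → ∑ℓ (map (_∷ᶠ f) (allFin m)) h)
    ≡⟨ ∑ℓ-cong (allFuns n m) (λ f → trans (∑ℓ-map (_∷ᶠ f) (allFin m) h) (∑ℓ-allFin m _)) ⟩
  ∑ℓ (allFuns n m) (λ f → ∑ℤ (λ j → h (j ∷ᶠ f))) ∎

Extensional : ∀ {n m} → ((Fin n → Fin m) → ℤ) → Set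
Extensional h = ∀ {f g} → f ≗ g → h f ≡ h g

∑ℓ-allFuns-δ : ∀ n m (g : Fin n → Fin m) (h : (Fin n → Fin m) → ℤ) → Extensional h →
  ∑ℓ (allFuns n m) (λ f → when (f ≗? g) (h f)) ≡ h g
∑ℓ-allFuns-δ zero m g h ext = trans (ℤP.+-identityʳ _) (ext (λ ()))
∑ℓ-allFuns-δ (suc n) m g h ext = begin
  ∑ℓ (allFuns (suc n) m) (λ f → when (f ≗? g) (h f))
    ≡⟨ ∑ℓ-allFuns-suc n m _ ⟩
  ∑ℓ (allFuns n m) (λ f → ∑ℤ (λ j → when ((j ∷ᶠ f) ≗? g) (h (j ∷ᶠ f))))
    ≡⟨ ∑ℓ-cong (allFuns n m) (λ f → sum-cong-≗ (λ j → split j f)) ⟩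
  ∑ℓ (allFuns n m) (λ f → ∑ℤ (λ j → when (j ≟ᶠ g zero) (when (f ≗? (g ∘ suc)) (h (j ∷ᶠ f)))))
    ≡⟨ ∑ℓ-cong (allFuns n m) (λ f → ∑ℤ-δ (g zero) _) ⟩
  ∑ℓ (allFuns n m) (λ f → when (f ≗? (g ∘ suc)) (h (g zero ∷ᶠ f)))
    ≡⟨ ∑ℓ-allFuns-δ n m (g ∘ suc) (λ f → h (g zero ∷ᶠ f)) (λ e → ext (λ { zero → refl ; (suc i) → e i })) ⟩
  h (g zero ∷ᶠ (g ∘ suc))
    ≡⟨ ext (λ { zero → refl ; (suc i) → refl }) ⟩
  h g ∎
  where
  split : ∀ j f → when ((j ∷ᶠ f) ≗? g) (h (j ∷ᶠ f))
                ≡ when (j ≟ᶠ g zero) (when (f ≗? (g ∘ suc)) (h (j ∷ᶠ f)))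
  split j f = trans
    (when-⇔ ((j ∷ᶠ f) ≗? g) ((j ≟ᶠ g zero) ×-dec (f ≗? (g ∘ suc)))
      (mk⇔ (λ e → e zero , e ∘ suc) (λ { (e , e′) zero → e ; (e , e′) (suc i) → e′ i })) _)
    (when-× (j ≟ᶠ g zero) (f ≗? (g ∘ suc)) _)

extend : ∀ {n} → Fin (suc n) → Fin (suc n) → (Fin n → Fin n) → Fin (suc n) → Fin (suc n)
extend k v τ u with v ≟ᶠ u
... | yes _   = k
... | no v≢u = punchIn k (τ (punchOut v≢u))

module _ {n} (k v : Fin (suc n)) (τ : Fin n → Fin n) where

  extend-at : extend k v τ v ≡ k
  extend-at with v ≟ᶠ v
  ... | yes _   = refl
  ... | no v≢v = contradiction refl v≢v

  extend-punchOut : ∀ {u} (v≢u : v ≢ u) → extend k v τ u ≡ punchIn k (τ (punchOut v≢u))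
  extend-punchOut {u} v≢u with v ≟ᶠ u
  ... | yes v≡u = contradiction v≡u v≢u
  ... | no _     = cong (punchIn k ∘ τ) (punchOut-cong v refl)

  extend-punchIn : ∀ x → extend k v τ (punchIn v x) ≡ punchIn k (τ x)
  extend-punchIn x = trans (extend-punchOut (punchInᵢ≢i v x ∘ sym)) (cong (punchIn k ∘ τ) (punchOut-punchIn v))

  extend-punchOut≢k : ∀ {u} (v≢u : v ≢ u) → extend k v τ u ≢ k
  extend-punchOut≢k v≢u e = punchInᵢ≢i k _ (trans (sym (extend-punchOut v≢u)) e)

IsBijection-resp : ∀ {n} {f g : Fin n → Fin n} → f ≗ g → IsBijection f → IsBijection g
IsBijection-resp f≗g (inj , surj) =
  (λ i j e → inj i j (trans (f≗g i) (trans e (sym (f≗g j))))) ,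
  (λ y → proj₁ (surj y) , trans (sym (f≗g _)) (proj₂ (surj y)))

module _ {n} (k v : Fin (suc n)) (τ : Fin n → Fin n) where

  extend-bijective : IsBijection τ → IsBijection (extend k v τ)
  extend-bijective (inj , surj) = inj′ , surj′
    where
    inj′ : ∀ i j → extend k v τ i ≡ extend k v τ j → i ≡ j
    inj′ i j e = cases (v ≟ᶠ i) (v ≟ᶠ j)
      where
      cases : Dec (v ≡ i) → Dec (v ≡ j) → i ≡ j
      cases (yes refl) (yes refl) = refl
      cases (yes refl) (no v≢j)   = contradiction (trans (sym e) (extend-at k v τ)) (extend-punchOut≢k k v τ v≢j)
      cases (no v≢i)   (yes refl) = contradiction (trans e (extend-at k v τ)) (extend-punchOut≢k k v τ v≢i)
      cases (no v≢i)   (no v≢j)   = punchOut-injective v≢i v≢j (inj _ _ (punchIn-injective k _ _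
        (trans (sym (extend-punchOut k v τ v≢i)) (trans e (extend-punchOut k v τ v≢j)))))
    surj′ : ∀ y → ∃ λ u → extend k v τ u ≡ y
    surj′ y with k ≟ᶠ y
    ... | yes k≡y = v , trans (extend-at k v τ) k≡y
    ... | no k≢y  = punchIn v x , (begin
      extend k v τ (punchIn v x) ≡⟨ extend-punchIn k v τ x ⟩
      punchIn k (τ x)            ≡⟨ cong (punchIn k) (proj₂ (surj (punchOut k≢y))) ⟩
      punchIn k (punchOut k≢y)   ≡⟨ punchIn-punchOut k≢y ⟩
      y                          ∎)
      where x = proj₁ (surj (punchOut k≢y))

  bijective-extend : IsBijection (extend k v τ) → IsBijection τ
  bijective-extend (inj , surj) = inj′ , surj′
    where
    inj′ : ∀ x y → τ x ≡ τ y → x ≡ y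
    inj′ x y e = punchIn-injective v x y (inj _ _
      (trans (extend-punchIn k v τ x) (trans (cong (punchIn k) e) (sym (extend-punchIn k v τ y)))))
    surj′ : ∀ y → ∃ λ x → τ x ≡ y
    surj′ y with v ≟ᶠ proj₁ (surj (punchIn k y))
    ... | yes v≡u = contradiction
          (trans (sym (proj₂ (surj (punchIn k y)))) (trans (cong (extend k v τ) (sym v≡u)) (extend-at k v τ)))
          (punchInᵢ≢i k y)
    ... | no v≢u  = punchOut v≢u ,
          punchIn-injective k _ _ (trans (sym (extend-punchOut k v τ v≢u)) (proj₂ (surj (punchIn k y))))

module Decomposition {n} (k : Fin (suc n)) {σ : Fin (suc n) → Fin (suc n)} (σ-bij : IsBijection σ) where

  v₀ : Fin (suc n)
  v₀ = proj₁ (proj₂ σ-bij k)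

  σv₀≡k : σ v₀ ≡ k
  σv₀≡k = proj₂ (proj₂ σ-bij k)

  k≢σ-punchIn : ∀ x → k ≢ σ (punchIn v₀ x)
  k≢σ-punchIn x e = punchInᵢ≢i v₀ x (sym (proj₁ σ-bij _ _ (trans σv₀≡k e)))

  τ₀ : Fin n → Fin n
  τ₀ x = punchOut (k≢σ-punchIn x)

  ≗-extend-τ₀ : ∀ τ → τ ≗ τ₀ → σ ≗ extend k v₀ τ
  ≗-extend-τ₀ τ τ≗τ₀ u = cases (v₀ ≟ᶠ u)
    where
    cases : Dec (v₀ ≡ u) → σ u ≡ extend k v₀ τ u
    cases (yes refl) = trans σv₀≡k (sym (extend-at k v₀ τ))
    cases (no v₀≢u)  = sym (begin
      extend k v₀ τ u                 ≡⟨ extend-punchOut k v₀ τ v₀≢u ⟩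
      punchIn k (τ (punchOut v₀≢u))   ≡⟨ cong (punchIn k) (τ≗τ₀ _) ⟩
      punchIn k (τ₀ (punchOut v₀≢u))  ≡⟨ punchIn-punchOut _ ⟩
      σ (punchIn v₀ (punchOut v₀≢u))  ≡⟨ cong σ (punchIn-punchOut v₀≢u) ⟩
      σ u                             ∎)

  ≗-extend⇔ : ∀ v τ → (IsBijection τ × σ ≗ extend k v τ) ⇔ (v ≡ v₀ × τ ≗ τ₀)
  ≗-extend⇔ v τ = mk⇔ to from
    where
    to : IsBijection τ × σ ≗ extend k v τ → v ≡ v₀ × τ ≗ τ₀
    to (_ , σ≗) = v≡v₀ , τ≗τ₀
      where
      v≡v₀ : v ≡ v₀
      v≡v₀ = proj₁ σ-bij v v₀ (trans (σ≗ v) (trans (extend-at k v τ) (sym σv₀≡k)))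
      τ≗τ₀ : τ ≗ τ₀
      τ≗τ₀ x = sym (begin
        punchOut (k≢σ-punchIn x)   ≡⟨ punchOut-cong k (trans (σ≗ _) (trans (cong (λ w → extend k v τ (punchIn w x)) (sym v≡v₀))
                                                                          (extend-punchIn k v τ x))) ⟩
        punchOut (punchInᵢ≢i k (τ x) ∘ sym) ≡⟨ punchOut-punchIn k ⟩
        τ x                        ∎)
    from : v ≡ v₀ × τ ≗ τ₀ → IsBijection τ × σ ≗ extend k v τ
    from (refl , τ≗τ₀) = bijective-extend k v τ (IsBijection-resp σ≗ σ-bij) , σ≗
      where σ≗ = ≗-extend-τ₀ τ τ≗τ₀

-- A bijection σ is extend k v τ, up to ≗, for exactly one v (namely σ⁻¹ k) and one bijection τ.
∑-extend-fiber : ∀ {n} (k : Fin (suc n)) (σ : Fin (suc n) → Fin (suc n)) (x : ℤ) →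
  ∑ℓ (allFin (suc n)) (λ v → ∑ℓ (bijections n) (λ τ → when (σ ≗? extend k v τ) x))
    ≡ when (isBijection? σ) x
∑-extend-fiber {n} k σ x =
  trans (∑ℓ-cong (allFin (suc n)) (λ v → trans (∑ℓ-filter isBijection? (allFuns n n) (λ τ → when (σ ≗? extend k v τ) x))
                                                 (∑ℓ-cong (allFuns n n) (λ τ → sym (when-× (isBijection? τ) (σ ≗? extend k v τ) x)))))
        (count (isBijection? σ))
  where
  count : (d : Dec (IsBijection σ)) →
    ∑ℓ (allFin (suc n)) (λ v → ∑ℓ (allFuns n n) (λ τ → when (isBijection? τ ×-dec (σ ≗? extend k v τ)) x))
      ≡ when d x
  count (no ¬σ-bij) = ∑ℓ-zero (allFin (suc n)) (λ v → ∑ℓ-zero (allFuns n n) (λ τ →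
    when-no (isBijection? τ ×-dec (σ ≗? extend k v τ))
      (λ (τ-bij , σ≗) → ¬σ-bij (IsBijection-resp (sym ∘ σ≗) (extend-bijective k v τ τ-bij))) x))
  count (yes σ-bij) = begin
    ∑ℓ (allFin (suc n)) (λ v → ∑ℓ (allFuns n n) (λ τ → when (isBijection? τ ×-dec (σ ≗? extend k v τ)) x))
      ≡⟨ ∑ℓ-cong (allFin (suc n)) (λ v → ∑ℓ-cong (allFuns n n) (λ τ →
           trans (when-⇔ (isBijection? τ ×-dec (σ ≗? extend k v τ)) ((v ≟ᶠ v₀) ×-dec (τ ≗? τ₀)) (≗-extend⇔ v τ) x)
                 (when-× (v ≟ᶠ v₀) (τ ≗? τ₀) x))) ⟩
    ∑ℓ (allFin (suc n)) (λ v → ∑ℓ (allFuns n n) (λ τ → when (v ≟ᶠ v₀) (when (τ ≗? τ₀) x)))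
      ≡⟨ ∑ℓ-cong (allFin (suc n)) (λ v → ∑ℓ-when (v ≟ᶠ v₀) (allFuns n n) (λ τ → when (τ ≗? τ₀) x)) ⟩
    ∑ℓ (allFin (suc n)) (λ v → when (v ≟ᶠ v₀) (∑ℓ (allFuns n n) (λ τ → when (τ ≗? τ₀) x)))
      ≡⟨ ∑ℓ-cong (allFin (suc n)) (λ v → cong (when (v ≟ᶠ v₀)) (∑ℓ-allFuns-δ n n τ₀ (λ _ → x) (λ _ → refl))) ⟩
    ∑ℓ (allFin (suc n)) (λ v → when (v ≟ᶠ v₀) x)
      ≡⟨ trans (∑ℓ-allFin (suc n) (λ v → when (v ≟ᶠ v₀) x)) (∑ℤ-δ v₀ (λ _ → x)) ⟩
    x ∎
    where open Decomposition k σ-bij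

∑-bijections-extend : ∀ n (k : Fin (suc n)) (G : (Fin (suc n) → Fin (suc n)) → ℤ) → Extensional G →
  ∑ℓ (bijections (suc n)) G ≡ ∑ℤ (λ v → ∑ℓ (bijections n) (λ τ → G (extend k v τ)))
∑-bijections-extend n k G ext = begin
  ∑ℓ (bijections (suc n)) G
    ≡⟨ ∑ℓ-filter isBijection? Fs G ⟩
  ∑ℓ Fs (λ σ → when (isBijection? σ) (G σ))
    ≡⟨ ∑ℓ-cong Fs (λ σ → sym (∑-extend-fiber k σ (G σ))) ⟩
  ∑ℓ Fs (λ σ → ∑ℓ Vs (λ v → ∑ℓ (bijections n) (λ τ → when (σ ≗? extend k v τ) (G σ))))
    ≡⟨ ∑ℓ-comm Fs Vs _ ⟩
  ∑ℓ Vs (λ v → ∑ℓ Fs (λ σ → ∑ℓ (bijections n) (λ τ → when (σ ≗? extend k v τ) (G σ))))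
    ≡⟨ ∑ℓ-cong Vs (λ v → ∑ℓ-comm Fs (bijections n) _) ⟩
  ∑ℓ Vs (λ v → ∑ℓ (bijections n) (λ τ → ∑ℓ Fs (λ σ → when (σ ≗? extend k v τ) (G σ))))
    ≡⟨ ∑ℓ-cong Vs (λ v → ∑ℓ-cong (bijections n) (λ τ → ∑ℓ-allFuns-δ (suc n) (suc n) (extend k v τ) G ext)) ⟩
  ∑ℓ Vs (λ v → ∑ℓ (bijections n) (λ τ → G (extend k v τ)))
    ≡⟨ ∑ℓ-allFin (suc n) (λ v → ∑ℓ (bijections n) (λ τ → G (extend k v τ))) ⟩
  ∑ℤ (λ v → ∑ℓ (bijections n) (λ τ → G (extend k v τ))) ∎
  where
  Fs = allFuns (suc n) (suc n)
  Vs = allFin (suc n)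

-- Descents

punchIn-<⇔ : ∀ {n} (k : Fin (suc n)) (a b : Fin n) → (a Fin.< b) ⇔ (punchIn k a Fin.< punchIn k b)
punchIn-<⇔ k a b = mk⇔
  (λ a<b → ≤∧≢⇒< (punchIn-mono-≤ k a b (ℕP.<⇒≤ a<b)) (<⇒≢ a<b ∘ punchIn-injective k a b))
  (λ a<b → ≤∧≢⇒< (punchIn-cancel-≤ k a b (ℕP.<⇒≤ a<b)) (<⇒≢ a<b ∘ cong (punchIn k)))

module _ {n r} (part : Fin n → Fin r) where

  descent? : (σ : Fin n → Fin n) (u w : Fin n) → Dec (Arc part u w × σ w Fin.< σ u)
  descent? σ u w = arc? part u w ×-dec (σ w <? σ u)

  des≡∑ : ∀ σ → des part σ ≡ ∑ℕ (λ u → ∑ℕ (λ w → 𝟙 (descent? σ u w)))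
  des≡∑ σ = length-filter-cartesianProduct (λ (u , w) → descent? σ u w) (λ i → i) (λ i → i)

  des-cong : ∀ {σ σ′} → σ ≗ σ′ → des part σ ≡ des part σ′
  des-cong {σ} {σ′} σ≗σ′ = begin
    des part σ                                          ≡⟨ des≡∑ σ ⟩
    ∑ℕ (λ u → ∑ℕ (λ w → 𝟙 (descent? σ u w)))           ≡⟨ ℕΣ.sum-cong-≗ (λ u → ℕΣ.sum-cong-≗ (λ w →
                                                             cong₂ (λ a b → 𝟙 (arc? part u w ×-dec (a <? b))) (σ≗σ′ w) (σ≗σ′ u))) ⟩
    ∑ℕ (λ u → ∑ℕ (λ w → 𝟙 (descent? σ′ u w)))          ≡⟨ des≡∑ σ′ ⟨
    des part σ′                                         ∎

module _ {n r} (part : Fin (suc n) → Fin r) (v : Fin (suc n)) where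

  inDegree outDegree : ℕ
  inDegree  = ∑ℕ (λ x → 𝟙 (arc? part (punchIn v x) v))
  outDegree = ∑ℕ (λ y → 𝟙 (arc? part v (punchIn v y)))

  des-extend : ∀ k τ → des part (extend k v τ) ≡
    ∑ℕ (λ y → 𝟙 (arc? part v (punchIn v y) ×-dec (punchIn k (τ y) <? k)))
      ℕ.+ (∑ℕ (λ x → 𝟙 (arc? part (punchIn v x) v ×-dec (k <? punchIn k (τ x))))
      ℕ.+ des (deleteVertex part v) τ)
  des-extend k τ = begin
    des part σ
      ≡⟨ des≡∑ part σ ⟩
    ∑ℕ (λ u → ∑ℕ (λ w → 𝟙 (descent? part σ u w)))
      ≡⟨ ∑ℕ-remove² v (λ u w → 𝟙 (descent? part σ u w)) ⟩
    𝟙 (descent? part σ v v) ℕ.+ (∑ℕ (λ y → 𝟙 (descent? part σ v (punchIn v y)))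
      ℕ.+ (∑ℕ (λ x → 𝟙 (descent? part σ (punchIn v x) v))
      ℕ.+ ∑ℕ (λ x → ∑ℕ (λ y → 𝟙 (descent? part σ (punchIn v x) (punchIn v y))))))
      ≡⟨ cong₂ ℕ._+_ no-loop (cong₂ ℕ._+_ (ℕΣ.sum-cong-≗ out-arc) (cong₂ ℕ._+_ (ℕΣ.sum-cong-≗ in-arc) rest)) ⟩
    0 ℕ.+ (∑ℕ (λ y → 𝟙 (arc? part v (punchIn v y) ×-dec (punchIn k (τ y) <? k)))
      ℕ.+ (∑ℕ (λ x → 𝟙 (arc? part (punchIn v x) v ×-dec (k <? punchIn k (τ x))))
      ℕ.+ des (deleteVertex part v) τ)) ∎
    where
    σ = extend k v τ

    relabel : ∀ u w {a b} → σ u ≡ a → σ w ≡ b → 𝟙 (descent? part σ u w) ≡ 𝟙 (arc? part u w ×-dec (b <? a))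
    relabel u w = cong₂ (λ a b → 𝟙 (arc? part u w ×-dec (b <? a)))

    no-loop : 𝟙 (descent? part σ v v) ≡ 0
    no-loop = 𝟙-no (descent? part σ v v) (λ (_ , σv<σv) → <-irrefl refl σv<σv)

    out-arc : ∀ y → 𝟙 (descent? part σ v (punchIn v y)) ≡ 𝟙 (arc? part v (punchIn v y) ×-dec (punchIn k (τ y) <? k))
    out-arc y = relabel v (punchIn v y) (extend-at k v τ) (extend-punchIn k v τ y)

    in-arc : ∀ x → 𝟙 (descent? part σ (punchIn v x) v) ≡ 𝟙 (arc? part (punchIn v x) v ×-dec (k <? punchIn k (τ x)))
    in-arc x = relabel (punchIn v x) v (extend-punchIn k v τ x) (extend-at k v τ)

    rest : ∑ℕ (λ x → ∑ℕ (λ y → 𝟙 (descent? part σ (punchIn v x) (punchIn v y)))) ≡ des (deleteVertex part v) τ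
    rest = trans (ℕΣ.sum-cong-≗ λ x → ℕΣ.sum-cong-≗ λ y → trans
      (relabel (punchIn v x) (punchIn v y) (extend-punchIn k v τ x) (extend-punchIn k v τ y))
      (𝟙-⇔ (arc? part (punchIn v x) (punchIn v y) ×-dec (punchIn k (τ y) <? punchIn k (τ x)))
           (descent? (deleteVertex part v) τ x y)
           (⇔.refl ×-⇔ ⇔.sym (punchIn-<⇔ k (τ y) (τ x)))))
      (sym (des≡∑ (deleteVertex part v) τ))

  des-extend-zero : ∀ τ → des part (extend zero v τ) ≡ inDegree ℕ.+ des (deleteVertex part v) τ
  des-extend-zero τ = trans (des-extend zero τ) (begin
    ∑ℕ (λ y → 𝟙 (arc? part v (punchIn v y) ×-dec (suc (τ y) <? zero {n}))) ℕ.+ (in-descents ℕ.+ des′)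
      ≡⟨ cong (ℕ._+ (in-descents ℕ.+ des′))
           (∑ℕ-zero (λ y → 𝟙-no (arc? part v (punchIn v y) ×-dec (suc (τ y) <? zero {n})) (λ ()))) ⟩
    in-descents ℕ.+ des′
      ≡⟨ cong (ℕ._+ des′) (ℕΣ.sum-cong-≗ (λ x → 𝟙-⇔ (arc? part (punchIn v x) v ×-dec (zero {n} <? suc (τ x)))
                                                   (arc? part (punchIn v x) v) (mk⇔ proj₁ (_, ℕ.z<s)))) ⟩
    inDegree ℕ.+ des′ ∎)
    where
    des′ = des (deleteVertex part v) τ
    in-descents = ∑ℕ (λ x → 𝟙 (arc? part (punchIn v x) v ×-dec (zero {n} <? suc (τ x))))

  des-extend-last : ∀ τ → des part (extend (fromℕ n) v τ) ≡ outDegree ℕ.+ des (deleteVertex part v) τ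
  des-extend-last τ = trans (des-extend (fromℕ n) τ) (cong₂ ℕ._+_
    (ℕΣ.sum-cong-≗ (λ y → 𝟙-⇔ (arc? part v (punchIn v y) ×-dec (punchIn (fromℕ n) (τ y) <? fromℕ n))
                             (arc? part v (punchIn v y))
                             (mk⇔ proj₁ (_, ≤∧≢⇒< (≤fromℕ _) (punchInᵢ≢i (fromℕ n) (τ y))))))
    (cong (ℕ._+ des (deleteVertex part v) τ)
      (∑ℕ-zero (λ x → 𝟙-no (arc? part (punchIn v x) v ×-dec (fromℕ n <? punchIn (fromℕ n) (τ x)))
                           (λ (_ , l) → ℕP.<⇒≱ l (≤fromℕ _))))))

AD-1-expansion : ∀ {n r} (part : Fin (suc n) → Fin r) (k : Fin (suc n)) (e : Fin (suc n) → ℕ) →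
  (∀ v τ → des part (extend k v τ) ≡ e v ℕ.+ des (deleteVertex part v) τ) →
  AD-1 part ≡ ∑ℤ (λ v → -1ℤ ^ e v * AD-1 (deleteVertex part v))
AD-1-expansion {n} part k e des-ext = trans
  (∑-bijections-extend n k (λ σ → -1ℤ ^ des part σ) (cong (-1ℤ ^_) ∘ des-cong part))
  (sum-cong-≗ λ v → trans
    (∑ℓ-cong (bijections n) (λ τ → trans (cong (-1ℤ ^_) (des-ext v τ)) (ℤP.^-distribˡ-+-* -1ℤ (e v) _)))
    (∑ℓ-*ˡ (bijections n) (-1ℤ ^ e v) (λ τ → -1ℤ ^ des (deleteVertex part v) τ)))

-- The cycle

next-view : ∀ {k} (i : Fin (suc k)) →
  (toℕ i ≡ k × toℕ (next i) ≡ 0) ⊎ (toℕ i ℕ.< k × toℕ (next i) ≡ suc (toℕ i))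
next-view {k} i with ℕP.m≤n⇒m<n∨m≡n (ℕ.s≤s⁻¹ (toℕ<n i))
... | inj₁ i<k = inj₂ (i<k , trans (toℕ-fromℕ< _) (m<n⇒m%n≡m (ℕ.s≤s i<k)))
... | inj₂ i≡k = inj₁ (i≡k , trans (toℕ-fromℕ< _) (trans (cong (λ j → suc j ℕ.% suc k) i≡k) (n%n≡0 (suc k))))

next-injective : ∀ {r} (i j : Fin r) → next i ≡ next j → i ≡ j
next-injective {suc k} i j e with next-view i | next-view j
... | inj₁ (i≡k , _)    | inj₁ (j≡k , _)    = toℕ-injective (trans i≡k (sym j≡k))
... | inj₁ (_ , ni≡0)   | inj₂ (_ , nj≡1+j) = contradiction (trans (sym ni≡0) (trans (cong toℕ e) nj≡1+j)) λ ()
... | inj₂ (_ , ni≡1+i) | inj₁ (_ , nj≡0)   = contradiction (trans (sym nj≡0) (trans (cong toℕ (sym e)) ni≡1+i)) λ ()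
... | inj₂ (_ , ni≡1+i) | inj₂ (_ , nj≡1+j) = toℕ-injective (ℕP.suc-injective (trans (sym ni≡1+i) (trans (cong toℕ e) nj≡1+j)))

prev : ∀ {r} → Fin r → Fin r
prev {suc k} zero    = fromℕ k
prev {suc k} (suc j) = inject₁ j

next-prev : ∀ {r} (i : Fin r) → next (prev i) ≡ i
next-prev {suc k} zero = toℕ-injective (from-view (next-view (fromℕ k)))
  where
  from-view : _ → toℕ (next (fromℕ k)) ≡ 0
  from-view (inj₁ (_ , e))   = e
  from-view (inj₂ (k<k , _)) = contradiction (subst (ℕ._< k) (toℕ-fromℕ k) k<k) (ℕP.<-irrefl refl)
next-prev {suc (suc k)} (suc j) = toℕ-injective (from-view (next-view (inject₁ j)))
  where
  from-view : _ → toℕ (next (inject₁ j)) ≡ suc (toℕ j)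
  from-view (inj₁ (j≡k , _)) = contradiction (subst (ℕ._< suc k) (trans (sym (toℕ-inject₁ j)) j≡k) (toℕ<n j)) (ℕP.<-irrefl refl)
  from-view (inj₂ (_ , e))   = trans e (cong suc (toℕ-inject₁ j))

next≡⇒≡prev : ∀ {r} {i j : Fin r} → next i ≡ j → i ≡ prev j
next≡⇒≡prev {j = j} e = next-injective _ _ (trans e (sym (next-prev j)))

next-≢ : ∀ {k} (i : Fin (suc (suc k))) → next i ≢ i
next-≢ {k} i e with next-view i
... | inj₁ (i≡1+k , ni≡0)  = contradiction (trans (sym i≡1+k) (trans (cong toℕ (sym e)) ni≡0)) λ ()
... | inj₂ (_ , ni≡1+i)    = ℕP.1+n≢n (trans (sym ni≡1+i) (cong toℕ e))

even⇒odd-suc : ∀ k → ¬ Odd k → Odd (suc k)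
even⇒odd-suc zero          _  = refl
even⇒odd-suc (suc zero)    ¬o = contradiction refl ¬o
even⇒odd-suc (suc (suc k)) ¬o = even⇒odd-suc k ¬o

odd⇒even-suc : ∀ k → Odd k → ¬ Odd (suc k)
odd⇒even-suc (suc zero)    _ ()
odd⇒even-suc (suc (suc k)) o = odd⇒even-suc k o

-1^-odd : ∀ k → Odd k → -1ℤ ^ k ≡ -1ℤ
-1^-odd (suc zero)    _ = refl
-1^-odd (suc (suc k)) o = trans (sym (ℤP.*-assoc -1ℤ -1ℤ (-1ℤ ^ k))) (trans (ℤP.*-identityˡ _) (-1^-odd k o))

-1^-even : ∀ k → ¬ Odd k → -1ℤ ^ k ≡ 1ℤ
-1^-even zero          _  = refl
-1^-even (suc zero)    ¬o = contradiction refl ¬o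
-1^-even (suc (suc k)) ¬o = trans (sym (ℤP.*-assoc -1ℤ -1ℤ (-1ℤ ^ k))) (trans (ℤP.*-identityˡ _) (-1^-even k ¬o))

-1^-half-+2 : ∀ m → -1ℤ ^ ((2 ℕ.+ m) / 2) ≡ -1ℤ * -1ℤ ^ (m / 2)
-1^-half-+2 m = cong (-1ℤ ^_) (m/n≡1+[m∸n]/n {2 ℕ.+ m} {2} (ℕ.s≤s (ℕ.s≤s ℕ.z≤n)))

-1^-neighbours-cancel : ∀ {m m′} a c →
  m ≡ 𝟙 (odd? a) ℕ.+ 𝟙 (odd? c) ℕ.+ m′ ⊎ m′ ≡ 𝟙 (odd? a) ℕ.+ 𝟙 (odd? c) ℕ.+ m →
  Odd m → ¬ Odd m′ → -1ℤ ^ a + -1ℤ ^ c ≡ 0ℤ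
-1^-neighbours-cancel {m} {m′} a c shift om em′ = cases (odd? a) (odd? c) shift
  where
  cases : (a? : Dec (Odd a)) (c? : Dec (Odd c)) →
          m ≡ 𝟙 a? ℕ.+ 𝟙 c? ℕ.+ m′ ⊎ m′ ≡ 𝟙 a? ℕ.+ 𝟙 c? ℕ.+ m → -1ℤ ^ a + -1ℤ ^ c ≡ 0ℤ
  cases (yes oa) (no ec)  _ = cong₂ _+_ (-1^-odd a oa) (-1^-even c ec)
  cases (no ea)  (yes oc) _ = cong₂ _+_ (-1^-even a ea) (-1^-odd c oc)
  cases (yes _)  (yes _)  (inj₁ refl) = ⊥-elim (em′ om)
  cases (yes _)  (yes _)  (inj₂ refl) = ⊥-elim (em′ om)
  cases (no _)   (no _)   (inj₁ refl) = ⊥-elim (em′ om)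
  cases (no _)   (no _)   (inj₂ refl) = ⊥-elim (em′ om)

-1^-half-shift : ∀ {m m′} a c →
  m ≡ 𝟙 (odd? a) ℕ.+ 𝟙 (odd? c) ℕ.+ m′ ⊎ m′ ≡ 𝟙 (odd? a) ℕ.+ 𝟙 (odd? c) ℕ.+ m →
  ¬ Odd m → ¬ Odd m′ → -1ℤ ^ (m / 2) * -1ℤ ^ a ≡ -1ℤ ^ (m′ / 2)
-1^-half-shift {m} {m′} a c shift em em′ = cases (odd? a) (odd? c) shift
  where
  cases : (a? : Dec (Odd a)) (c? : Dec (Odd c)) →
          m ≡ 𝟙 a? ℕ.+ 𝟙 c? ℕ.+ m′ ⊎ m′ ≡ 𝟙 a? ℕ.+ 𝟙 c? ℕ.+ m → -1ℤ ^ (m / 2) * -1ℤ ^ a ≡ -1ℤ ^ (m′ / 2)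
  cases (no ea) (no _) (inj₁ refl) = trans (cong (-1ℤ ^ (m / 2) *_) (-1^-even a ea)) (ℤP.*-identityʳ _)
  cases (no ea) (no _) (inj₂ refl) = trans (cong (-1ℤ ^ (m / 2) *_) (-1^-even a ea)) (ℤP.*-identityʳ _)
  cases (yes oa) (yes _) (inj₁ refl) = begin
    -1ℤ ^ ((2 ℕ.+ m′) / 2) * -1ℤ ^ a  ≡⟨ cong₂ _*_ (-1^-half-+2 m′) (-1^-odd a oa) ⟩
    -1ℤ * -1ℤ ^ (m′ / 2) * -1ℤ        ≡⟨ ℤP.*-comm (-1ℤ * -1ℤ ^ (m′ / 2)) -1ℤ ⟩
    -1ℤ * (-1ℤ * -1ℤ ^ (m′ / 2))      ≡⟨ ℤP.*-assoc -1ℤ -1ℤ (-1ℤ ^ (m′ / 2)) ⟨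
    1ℤ * -1ℤ ^ (m′ / 2)               ≡⟨ ℤP.*-identityˡ _ ⟩
    -1ℤ ^ (m′ / 2)                    ∎
    where open ≡-Reasoning
  cases (yes oa) (yes _) (inj₂ refl) = begin
    -1ℤ ^ (m / 2) * -1ℤ ^ a  ≡⟨ cong (-1ℤ ^ (m / 2) *_) (-1^-odd a oa) ⟩
    -1ℤ ^ (m / 2) * -1ℤ      ≡⟨ ℤP.*-comm (-1ℤ ^ (m / 2)) -1ℤ ⟩
    -1ℤ * -1ℤ ^ (m / 2)      ≡⟨ -1^-half-+2 m ⟨
    -1ℤ ^ ((2 ℕ.+ m) / 2)    ∎
    where open ≡-Reasoning
  cases (yes _) (no _)  (inj₁ refl) = ⊥-elim (em (even⇒odd-suc m′ em′))
  cases (yes _) (no _)  (inj₂ refl) = ⊥-elim (em′ (even⇒odd-suc m em))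
  cases (no _)  (yes _) (inj₁ refl) = ⊥-elim (em (even⇒odd-suc m′ em′))
  cases (no _)  (yes _) (inj₂ refl) = ⊥-elim (em′ (even⇒odd-suc m em))

i+i≡0⇒i≡0 : ∀ i → i + i ≡ 0ℤ → i ≡ 0ℤ
i+i≡0⇒i≡0 (ℤ.+ zero)  _ = refl
i+i≡0⇒i≡0 (ℤ.+ suc _) ()
i+i≡0⇒i≡0 ℤ.-[1+ _ ]  ()

-- Part sizes and m(D)

module _ {n r} (part : Fin (suc n) → Fin r) (v : Fin (suc n)) where

  partSize-deleteVertex : ∀ i → partSize part i ≡ 𝟙 (part v ≟ᶠ i) ℕ.+ partSize (deleteVertex part v) i
  partSize-deleteVertex i = begin
    partSize part i
      ≡⟨ length-filter-tabulate (λ u → part u ≟ᶠ i) (λ u → u) ⟩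
    ∑ℕ (λ u → 𝟙 (part u ≟ᶠ i))
      ≡⟨ ℕΣ.sum-remove {i = v} (λ u → 𝟙 (part u ≟ᶠ i)) ⟩
    𝟙 (part v ≟ᶠ i) ℕ.+ ∑ℕ (λ x → 𝟙 (part (punchIn v x) ≟ᶠ i))
      ≡⟨ cong (𝟙 (part v ≟ᶠ i) ℕ.+_) (length-filter-tabulate (λ x → part (punchIn v x) ≟ᶠ i) (λ x → x)) ⟨
    𝟙 (part v ≟ᶠ i) ℕ.+ partSize (deleteVertex part v) i ∎

  partSize-deleteVertex-≢ : ∀ {i} → part v ≢ i → partSize part i ≡ partSize (deleteVertex part v) i
  partSize-deleteVertex-≢ {i} pv≢i = trans (partSize-deleteVertex i)
    (cong (ℕ._+ partSize (deleteVertex part v) i) (𝟙-no (part v ≟ᶠ i) pv≢i))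

  partSize-deleteVertex-own : partSize part (part v) ≡ suc (partSize (deleteVertex part v) (part v))
  partSize-deleteVertex-own = trans (partSize-deleteVertex (part v))
    (cong (ℕ._+ partSize (deleteVertex part v) (part v)) (𝟙-yes (part v ≟ᶠ part v) refl))

  outDegree≡partSize : outDegree part v ≡ partSize (deleteVertex part v) (next (part v))
  outDegree≡partSize = sym (length-filter-tabulate (λ x → part (punchIn v x) ≟ᶠ next (part v)) (λ x → x))

  inDegree≡partSize : inDegree part v ≡ partSize (deleteVertex part v) (prev (part v))
  inDegree≡partSize = trans
    (ℕΣ.sum-cong-≗ (λ x → 𝟙-⇔ (arc? part (punchIn v x) v) (part (punchIn v x) ≟ᶠ prev (part v))
      (mk⇔ (λ e → next≡⇒≡prev (sym e)) (λ e → trans (sym (next-prev (part v))) (cong next (sym e))))))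
    (sym (length-filter-tabulate (λ x → part (punchIn v x) ≟ᶠ prev (part v)) (λ x → x)))

oddPair : ∀ {n r} → (Fin n → Fin r) → Fin r → ℕ
oddPair part i = 𝟙 (odd? (partSize part i) ×-dec odd? (partSize part (next i)))

mD≡∑ : ∀ {n r} (part : Fin n → Fin r) → mD part ≡ ∑ℕ (oddPair part)
mD≡∑ part = length-filter-tabulate (λ i → odd? (partSize part i) ×-dec odd? (partSize part (next i))) (λ i → i)

-- a, b, c play |V_{p-1}|, |V_p ∖ {v}|, |V_{p+1}|: deleting v flips the parity of |V_p|, which toggles
-- the two pairs of consecutive parts through p, and only those.
oddPairs-shift : ∀ a b c →
  let t = 𝟙 (odd? a) ℕ.+ 𝟙 (odd? c)
      withV    = 𝟙 (odd? a ×-dec odd? (suc b)) ℕ.+ 𝟙 (odd? (suc b) ×-dec odd? c)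
      withoutV = 𝟙 (odd? a ×-dec odd? b) ℕ.+ 𝟙 (odd? b ×-dec odd? c)
  in (withV ≡ t × withoutV ≡ 0) ⊎ (withV ≡ 0 × withoutV ≡ t)
oddPairs-shift a b c = cases (odd? a) (odd? b) (odd? (suc b))
  where
  cases : (a? : Dec (Odd a)) (b? : Dec (Odd b)) (b′? : Dec (Odd (suc b))) →
    (𝟙 (a? ×-dec b′?) ℕ.+ 𝟙 (b′? ×-dec odd? c) ≡ 𝟙 a? ℕ.+ 𝟙 (odd? c) × 𝟙 (a? ×-dec b?) ℕ.+ 𝟙 (b? ×-dec odd? c) ≡ 0)
    ⊎ (𝟙 (a? ×-dec b′?) ℕ.+ 𝟙 (b′? ×-dec odd? c) ≡ 0 × 𝟙 (a? ×-dec b?) ℕ.+ 𝟙 (b? ×-dec odd? c) ≡ 𝟙 a? ℕ.+ 𝟙 (odd? c))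
  cases _       (yes ob) (yes ob′) = contradiction ob′ (odd⇒even-suc b ob)
  cases _       (no eb)  (no eb′)  = contradiction (even⇒odd-suc b eb) eb′
  cases (yes _) (yes _)  (no _)    = inj₂ (refl , refl)
  cases (no _)  (yes _)  (no _)    = inj₂ (refl , refl)
  cases (yes _) (no _)   (yes _)   = inj₁ (refl , refl)
  cases (no _)  (no _)   (yes _)   = inj₁ (refl , refl)

module _ {n k} (part : Fin (suc n) → Fin (suc (suc k))) (v : Fin (suc n)) where

  private
    p = part v
    q = prev p
    del = deleteVertex part v
    s = partSize del
    t = 𝟙 (odd? (s q)) ℕ.+ 𝟙 (odd? (s (next p)))

    q≢p : q ≢ p
    q≢p q≡p = next-≢ q (trans (next-prev p) (sym q≡p))

    J : Fin k → Fin (suc (suc k))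
    J y = punchIn q (punchIn (punchOut q≢p) y)

    R : ∀ {m} → (Fin m → Fin (suc (suc k))) → ℕ
    R f = ∑ℕ (λ y → oddPair f (J y))

    mD-split : ∀ {m} (f : Fin m → Fin (suc (suc k))) → mD f ≡ (oddPair f q ℕ.+ oddPair f p) ℕ.+ R f
    mD-split f = trans (mD≡∑ f) (trans (∑ℕ-remove₂ q≢p (oddPair f)) (sym (ℕP.+-assoc (oddPair f q) _ _)))

    J≢p : ∀ y → J y ≢ p
    J≢p y e = punchInᵢ≢i (punchOut q≢p) y (punchIn-injective q _ _ (trans e (sym (punchIn-punchOut q≢p))))

    oddPair-rest : ∀ y → oddPair part (J y) ≡ oddPair del (J y)
    oddPair-rest y = cong₂ (λ a b → 𝟙 (odd? a ×-dec odd? b))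
      (partSize-deleteVertex-≢ part v (J≢p y ∘ sym))
      (partSize-deleteVertex-≢ part v (λ e → punchInᵢ≢i q _ (next≡⇒≡prev (sym e))))

    withV : oddPair part q ℕ.+ oddPair part p ≡
            𝟙 (odd? (s q) ×-dec odd? (suc (s p))) ℕ.+ 𝟙 (odd? (suc (s p)) ×-dec odd? (s (next p)))
    withV = cong₂ ℕ._+_
      (cong₂ (λ a b → 𝟙 (odd? a ×-dec odd? b))
        (partSize-deleteVertex-≢ part v (q≢p ∘ sym))
        (trans (cong (partSize part) (next-prev p)) (partSize-deleteVertex-own part v)))
      (cong₂ (λ a b → 𝟙 (odd? a ×-dec odd? b))
        (partSize-deleteVertex-own part v)
        (partSize-deleteVertex-≢ part v (λ e → next-≢ p (sym e))))

    withoutV : oddPair del q ℕ.+ oddPair del p ≡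
               𝟙 (odd? (s q) ×-dec odd? (s p)) ℕ.+ 𝟙 (odd? (s p) ×-dec odd? (s (next p)))
    withoutV = cong (λ i → 𝟙 (odd? (s q) ×-dec odd? (s i)) ℕ.+ oddPair del p) (next-prev p)

  mD-deleteVertex :
    mD part ≡ (𝟙 (odd? (s q)) ℕ.+ 𝟙 (odd? (s (next p)))) ℕ.+ mD del
    ⊎ mD del ≡ (𝟙 (odd? (s q)) ℕ.+ 𝟙 (odd? (s (next p)))) ℕ.+ mD part
  mD-deleteVertex with oddPairs-shift (s q) (s p) (s (next p))
  ... | inj₁ (withV≡t , withoutV≡0) = inj₁ (begin
    mD part                                        ≡⟨ mD-split part ⟩
    (oddPair part q ℕ.+ oddPair part p) ℕ.+ R part ≡⟨ cong₂ ℕ._+_ (trans withV withV≡t) (ℕΣ.sum-cong-≗ oddPair-rest) ⟩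
    t ℕ.+ R del                                    ≡⟨ cong (t ℕ.+_) (trans (mD-split del) (cong (ℕ._+ R del) (trans withoutV withoutV≡0))) ⟨
    t ℕ.+ mD del                                   ∎)
  ... | inj₂ (withV≡0 , withoutV≡t) = inj₂ (begin
    mD del                                         ≡⟨ mD-split del ⟩
    (oddPair del q ℕ.+ oddPair del p) ℕ.+ R del    ≡⟨ cong (ℕ._+ R del) (trans withoutV withoutV≡t) ⟩
    t ℕ.+ R del                                    ≡⟨ cong (t ℕ.+_) (ℕΣ.sum-cong-≗ oddPair-rest) ⟨
    t ℕ.+ R part                                   ≡⟨ cong (t ℕ.+_) (trans (mD-split part) (cong (ℕ._+ R part) (trans withV withV≡0))) ⟨
    t ℕ.+ mD part                                  ∎)

mD-empty : ∀ {r} (part : Fin 0 → Fin r) → mD part ≡ 0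
mD-empty part = trans (mD≡∑ part) (∑ℕ-zero {f = oddPair part} (λ _ → refl))

-- The deletion recursion

module _ {n r} (part : Fin n → Fin r) where

  signedA-odd : Odd (mD part) → signedA part ≡ 0ℤ
  signedA-odd o with odd? (mD part)
  ... | yes _ = refl
  ... | no ¬o = contradiction o ¬o

  signedA-even : ¬ Odd (mD part) → signedA part ≡ -1ℤ ^ (mD part / 2) * AD-1 part
  signedA-even ¬o with odd? (mD part)
  ... | yes o = contradiction o ¬o
  ... | no _  = refl

module _ {k : ℕ} where

  AD-1-odd : ∀ {n} (part : Fin n → Fin (suc (suc k))) → Odd (mD part) → AD-1 part ≡ 0ℤ
  AD-1-odd {zero}  part o = contradiction (subst Odd (mD-empty part) o) λ ()
  AD-1-odd {suc n} part o = i+i≡0⇒i≡0 (AD-1 part) (begin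
    AD-1 part + AD-1 part
      ≡⟨ cong₂ _+_ (AD-1-expansion part zero (inDegree part) (des-extend-zero part))
                   (AD-1-expansion part (fromℕ n) (outDegree part) (des-extend-last part)) ⟩
    ∑ℤ (λ v → -1ℤ ^ inDegree part v * A v) + ∑ℤ (λ v → -1ℤ ^ outDegree part v * A v)
      ≡⟨ ∑-distrib-+ (λ v → -1ℤ ^ inDegree part v * A v) (λ v → -1ℤ ^ outDegree part v * A v) ⟨
    ∑ℤ (λ v → -1ℤ ^ inDegree part v * A v + -1ℤ ^ outDegree part v * A v)
      ≡⟨ ∑ℤ-zero (λ v → trans (sym (ℤP.*-distribʳ-+ (A v) (-1ℤ ^ inDegree part v) (-1ℤ ^ outDegree part v)))
                               (cancel v (odd? (mD (deleteVertex part v))))) ⟩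
    0ℤ ∎)
    where
    A : Fin (suc n) → ℤ
    A v = AD-1 (deleteVertex part v)
    cancel : ∀ v → Dec (Odd (mD (deleteVertex part v))) →
             (-1ℤ ^ inDegree part v + -1ℤ ^ outDegree part v) * A v ≡ 0ℤ
    cancel v (yes o′) = trans (cong ((-1ℤ ^ inDegree part v + -1ℤ ^ outDegree part v) *_) (AD-1-odd (deleteVertex part v) o′))
                               (ℤP.*-zeroʳ (-1ℤ ^ inDegree part v + -1ℤ ^ outDegree part v))
    cancel v (no e′)  = trans (cong (_* A v) (begin
      -1ℤ ^ inDegree part v + -1ℤ ^ outDegree part v
        ≡⟨ cong₂ (λ a c → -1ℤ ^ a + -1ℤ ^ c) (inDegree≡partSize part v) (outDegree≡partSize part v) ⟩
      -1ℤ ^ partSize (deleteVertex part v) (prev (part v)) + -1ℤ ^ partSize (deleteVertex part v) (next (part v))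
        ≡⟨ -1^-neighbours-cancel (partSize (deleteVertex part v) (prev (part v))) (partSize (deleteVertex part v) (next (part v)))
             (mD-deleteVertex part v) o e′ ⟩
      0ℤ ∎)) (ℤP.*-zeroˡ (A v))

  deletion-identity : ∀ {n} (part : Fin (suc n) → Fin (suc (suc k))) → ¬ Odd (mD part) →
    -1ℤ ^ (mD part / 2) * AD-1 part ≡ ∑ℤ (λ v → signedA (deleteVertex part v))
  deletion-identity part e = begin
    -1ℤ ^ (mD part / 2) * AD-1 part
      ≡⟨ cong (-1ℤ ^ (mD part / 2) *_) (AD-1-expansion part zero (inDegree part) (des-extend-zero part)) ⟩
    -1ℤ ^ (mD part / 2) * ∑ℤ (λ v → -1ℤ ^ inDegree part v * AD-1 (deleteVertex part v))
      ≡⟨ *-distribˡ-sum (-1ℤ ^ (mD part / 2)) (λ v → -1ℤ ^ inDegree part v * AD-1 (deleteVertex part v)) ⟩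
    ∑ℤ (λ v → -1ℤ ^ (mD part / 2) * (-1ℤ ^ inDegree part v * AD-1 (deleteVertex part v)))
      ≡⟨ sum-cong-≗ (λ v → term v (odd? (mD (deleteVertex part v)))) ⟩
    ∑ℤ (λ v → signedA (deleteVertex part v)) ∎
    where
    term : ∀ v → Dec (Odd (mD (deleteVertex part v))) →
           -1ℤ ^ (mD part / 2) * (-1ℤ ^ inDegree part v * AD-1 (deleteVertex part v)) ≡ signedA (deleteVertex part v)
    term v (yes o′) = begin
      -1ℤ ^ (mD part / 2) * (-1ℤ ^ inDegree part v * AD-1 (deleteVertex part v))
        ≡⟨ cong (λ x → -1ℤ ^ (mD part / 2) * (-1ℤ ^ inDegree part v * x)) (AD-1-odd (deleteVertex part v) o′) ⟩
      -1ℤ ^ (mD part / 2) * (-1ℤ ^ inDegree part v * 0ℤ)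
        ≡⟨ cong (-1ℤ ^ (mD part / 2) *_) (ℤP.*-zeroʳ (-1ℤ ^ inDegree part v)) ⟩
      -1ℤ ^ (mD part / 2) * 0ℤ
        ≡⟨ ℤP.*-zeroʳ (-1ℤ ^ (mD part / 2)) ⟩
      0ℤ
        ≡⟨ signedA-odd (deleteVertex part v) o′ ⟨
      signedA (deleteVertex part v) ∎
    term v (no e′) = begin
      -1ℤ ^ (mD part / 2) * (-1ℤ ^ inDegree part v * AD-1 (deleteVertex part v))
        ≡⟨ ℤP.*-assoc (-1ℤ ^ (mD part / 2)) _ _ ⟨
      -1ℤ ^ (mD part / 2) * -1ℤ ^ inDegree part v * AD-1 (deleteVertex part v)
        ≡⟨ cong (λ a → -1ℤ ^ (mD part / 2) * -1ℤ ^ a * AD-1 (deleteVertex part v)) (inDegree≡partSize part v) ⟩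
      -1ℤ ^ (mD part / 2) * -1ℤ ^ partSize (deleteVertex part v) (prev (part v)) * AD-1 (deleteVertex part v)
        ≡⟨ cong (_* AD-1 (deleteVertex part v))
             (-1^-half-shift (partSize (deleteVertex part v) (prev (part v))) (partSize (deleteVertex part v) (next (part v)))
                             (mD-deleteVertex part v) e e′) ⟩
      -1ℤ ^ (mD (deleteVertex part v) / 2) * AD-1 (deleteVertex part v)
        ≡⟨ signedA-even (deleteVertex part v) e′ ⟨
      signedA (deleteVertex part v) ∎

  signedA-nonneg : ∀ {n} (part : Fin n → Fin (suc (suc k))) → 0ℤ ≤ℤ signedA part
  signedA-even-nonneg : ∀ {n} (part : Fin n → Fin (suc (suc k))) → ¬ Odd (mD part) →
                        0ℤ ≤ℤ -1ℤ ^ (mD part / 2) * AD-1 part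

  signedA-nonneg part = by-parity (odd? (mD part))
    where
    by-parity : Dec (Odd (mD part)) → 0ℤ ≤ℤ signedA part
    by-parity (yes o) = subst (0ℤ ≤ℤ_) (sym (signedA-odd part o)) ℤP.≤-refl
    by-parity (no e)  = subst (0ℤ ≤ℤ_) (sym (signedA-even part e)) (signedA-even-nonneg part e)

  -- For the empty digraph AD-1 computes to 1.
  signedA-even-nonneg {zero}  part _ rewrite mD-empty part = ℤ.+≤+ ℕ.z≤n
  signedA-even-nonneg {suc n} part e = subst (0ℤ ≤ℤ_) (sym (deletion-identity part e))
                                             (∑ℤ-nonneg (λ v → signedA-nonneg (deleteVertex part v)))

lemma3p14 : (r : ℕ) → 2 ≤ r → (n : ℕ) → (part : Fin (suc n) → Fin r) →
    (Odd (mD part) → AD-1 part ≡ 0ℤ)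
    × (¬ Odd (mD part) →
        (0ℤ ≤ℤ (-1ℤ ^ (mD part / 2)) * AD-1 part)
        × ((-1ℤ ^ (mD part / 2)) * AD-1 part ≡ deletionSum part))
lemma3p14 (suc (suc k)) _ n part =
  AD-1-odd part ,
  λ e → signedA-even-nonneg part e ,
        trans (deletion-identity part e) (sym (∑ℓ-allFin (suc n) (λ v → signedA (deleteVertex part v))))
lemma3p14 0             ()
lemma3p14 1             (ℕ.s≤s ())
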